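{- Let $m,t\in\mathbb{N}$, let $C$ be the cycle $C_{2m+2}$, let $K=K_{1,t}$ with parts $X=\{x\}$ and $Y=\{y_q:q\in[t]\}$, let $M=C\square K$, and let $\mathcal{H}$ be a $3$-fold cover of $M$. Then for each $q\in[t]$, at most one $\mathcal{H}_X$-coloring of $M_X$ is volatile for $M_{y_q}$.
   Context: A cover of a graph $G$ is a pair $\mathcal{H}=(L,H)$ with $H$ a graph and $L:V(G)\to\mathcal{P}(V(H))$ such that $\{L(v)\}$ partitions $V(H)$ into $|V(G)|$ parts, each $H[L(v)]$ is complete, edges of $H$ between distinct $L(u),L(v)$ occur only if $uv\in E(G)$, and for $uv\in E(G)$ these edges form a (possibly empty) matching; $3$-fold means all $|L(v)|=3$. An $\mathcal{H}$-coloring of $G$ is an independent set $I$ of $H$ with $|I\cap L(v)|=1$ for all $v$. $\square$ is the Cartesian product. Notation: $M_X=M[V(C)\times X]$, $M_{y_q}=M[V(C)\times\{y_q\}]$; $\mathcal{H}_X$ and $\mathcal{H}_{y_q}=(L_{y_q},H_{y_q})$ are the subcovers induced by $V(C)\times X$ and $V(C)\times\{y_q\}$ (restrict $L$ and take the induced subgraph of $H$ on the union of the corresponding lists). Given an $\mathcal{H}_X$-coloring $I$ of $M_X$, let $D_q=\{u\in V(H_{y_q}): N_H(u)\cap I=\emptyset\}$, $L'_{y_q}(w)=L_{y_q}(w)\cap D_q$, $\mathcal{H}'_{y_q}=(L'_{y_q},H[D_q])$. $I$ is volatile for $M_{y_q}$ if there is no independent set of $H[D_q]$ meeting each $L'_{y_q}(w)$,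 $w\in V(M_{y_q})$, in exactly one vertex. -}

module Defs where

open import Data.Nat using (ℕ; zero; suc; _+_; _*_)
open import Data.Fin using (Fin; toℕ)
open import Data.Product using (Σ; _×_; _,_)
open import Data.Sum using (_⊎_)
open import Relation.Nullary using (¬_)
open import Relation.Binary.PropositionalEquality using (_≡_; _≢_)

CycStep : (n : ℕ) → Fin n → Fin n → Set
CycStep n i j = (suc (toℕ i) ≡ toℕ j) ⊎ ((suc (toℕ i) ≡ n) × (toℕ j ≡ 0))

CycAdj : (n : ℕ) → Fin n → Fin n → Set
CycAdj n i j = CycStep n i j ⊎ CycStep n j i

data KV (t : ℕ) : Set where
  x : KV t
  y : Fin t → KV t

KAdj : (t : ℕ) → KV t → KV t → Set
KAdj t x     x     = Data.Empty.⊥ where import Data.Empty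
KAdj t x     (y _) = Data.Unit.⊤ where import Data.Unit
KAdj t (y _) x     = Data.Unit.⊤ where import Data.Unit
KAdj t (y _) (y _) = Data.Empty.⊥ where import Data.Empty

cyc : ℕ → ℕ
cyc m = 2 * m + 2

MV : ℕ → ℕ → Set
MV m t = Fin (cyc m) × KV t

MAdj : (m t : ℕ) → MV m t → MV m t → Set
MAdj m t (c , k) (c' , k') =
  ((c ≡ c') × KAdj t k k') ⊎ ((k ≡ k') × CycAdj (cyc m) c c')

-- A 3-fold cover of a graph with vertex set V and adjacency G.
-- V(H) = V × Fin 3 and L(v) = {v} × Fin 3.
record Cover3 {V : Set} (G : V → V → Set) : Set₁ where
  field
    Adj      : V × Fin 3 → V × Fin 3 → Set
    sym      : ∀ a b → Adj a b → Adj b a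
    irrefl   : ∀ a → ¬ Adj a a
    complete : ∀ v i j → i ≢ j → Adj (v , i) (v , j)
    edge     : ∀ v w i j → v ≢ w → Adj (v , i) (w , j) → G v w
    matching : ∀ v w i j k → v ≢ w → Adj (v , i) (w , j) → Adj (v , i) (w , k) → j ≡ k

module _ (m t : ℕ) (H : Cover3 (MAdj m t)) where
  open Cover3 H

  -- An H_X-colouring of M_X: choose one vertex (c , x) , f c of each list, forming an independent set.
  IsXColoring : (Fin (cyc m) → Fin 3) → Set
  IsXColoring f = ∀ c c' → ¬ Adj ((c , x) , f c) ((c' , x) , f c')

  InD : Fin t → (Fin (cyc m) → Fin 3) → Fin (cyc m) → Fin 3 → Set
  InD q I c i = ∀ c' → ¬ Adj ((c , y q) , i) ((c' , x) , I c')

  IsReducedYColoring : Fin t → (Fin (cyc m) → Fin 3) → (Fin (cyc m) → Fin 3) → Set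
  IsReducedYColoring q I g =
    (∀ c → InD q I c (g c)) × (∀ c c' → ¬ Adj ((c , y q) , g c) ((c' , y q) , g c'))

  Volatile : Fin t → (Fin (cyc m) → Fin 3) → Set
  Volatile q I = ¬ Σ (Fin (cyc m) → Fin 3) (IsReducedYColoring q I)

-- Restricted to the copy of C over y_q, the cover is a cover of the even cycle C whose lists lose at
-- most one colour each (the matching partner of the colour chosen at (c , x)), so every list keeps at
-- least two colours. Colouring greedily around the cycle can only fail at the last vertex, which has
-- two coloured neighbours. Exploiting the freedom in where to start, a volatile colouring forces every
-- list to lose exactly one colour r c, and the removed colour r c has no edge to the kept colours of
-- either neighbour. Now let I and J be volatile with removal functions r and r'. If r and r' agree at c
-- but not at next c, start a greedy J-colouring at next c with r (next c); if they disagree everywhere,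
-- alternate r c and the third colour around the even cycle. Either way J is not volatile, so r = r',
-- and then I = J because a colour at (c , y q) has only one neighbour in the list of (c , x).

module Submission where

open import Data.Bool using (Bool; true; false; not)
open import Data.Bool.Properties using (not-involutive)
open import Data.Empty using (⊥-elim)
open import Data.Fin using (Fin; toℕ; fromℕ<; _≟_)
open import Data.Fin.Patterns using (0F; 1F; 2F)
open import Data.Fin.Properties using (toℕ-injective; toℕ<n; toℕ-fromℕ<; any?; all?; sequence)
open import Data.Nat using (ℕ; zero; suc; pred; _+_; _*_; _≤_; _<_; z≤n; z<s; _<?_; NonZero; >-nonZero)
open import Data.Nat.Properties
  using (≤-antisym; ≮⇒≥; <-trans; suc-injective; 1+n≢n; n≤1+n; <⇒≢; n<1+n; suc-pred; ≤-trans; 1+n≰n;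
         n≤0⇒n≡0; <⇒≤pred; m≤n⇒m<n∨m≡n; ≤-pred; *-suc; m≤n+m)
open import Data.Product using (Σ; ∃; ∃-syntax; Σ-syntax; ∃₂; _×_; _,_; proj₁; proj₂)
open import Data.Sum using (_⊎_; inj₁; inj₂)
open import Data.Vec.Functional using (updateAt)
open import Data.Vec.Functional.Properties using (updateAt-updates; updateAt-minimal)
open import Effect.Monad using (RawMonad)
open import Function using (_∘_; const)
open import Relation.Binary.PropositionalEquality
open import Relation.Nullary using (¬_; Dec; yes; no; contradiction)
open import Relation.Nullary.Decidable
  using (decidable-stable; ¬¬-excluded-middle; from-yes; _→-dec_; ¬?; _×-dec_)
open import Relation.Nullary.Negation using (DoubleNegation; ¬¬-Monad)
open import Relation.Unary using (Decidable)

open import Defs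

AtMostOne : {A : Set} → (A → Set) → Set
AtMostOne P = ∀ {a b} → P a → P b → a ≡ b

HasTwo : {A : Set} → (A → Set) → Set
HasTwo P = ∃₂ λ i j → i ≢ j × P i × P j

≡-unique : {A : Set} (a : A) → AtMostOne (_≡ a)
≡-unique a a≡ b≡ = trans a≡ (sym b≡)

avoid : {A : Set} {L P : A → Set} → Decidable P → AtMostOne P → HasTwo L → ∃[ q ] L q × ¬ P q
avoid P? P-unique (i , j , i≢j , Li , Lj) with P? i | P? j
... | no ¬Pi | _      = i , Li , ¬Pi
... | yes _  | no ¬Pj = j , Lj , ¬Pj
... | yes Pi | yes Pj = contradiction (P-unique Pi Pj) i≢j

two-outside : {P : Fin 3 → Set} → Decidable P → AtMostOne P → HasTwo (λ i → ¬ P i)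
two-outside P? P-unique with P? 0F | P? 1F
... | yes P0 | _      = 1F , 2F , (λ ()) , (λ P1 → contradiction (P-unique P0 P1) λ ()) ,
                                          (λ P2 → contradiction (P-unique P0 P2) λ ())
... | no ¬P0 | yes P1 = 0F , 2F , (λ ()) , ¬P0 , (λ P2 → contradiction (P-unique P1 P2) λ ())
... | no ¬P0 | no ¬P1 = 0F , 1F , (λ ()) , ¬P0 , ¬P1

avoid-both : {P Q : Fin 3 → Set} → Decidable P → Decidable Q → AtMostOne P → AtMostOne Q →
  ∃[ q ] ¬ P q × ¬ Q q
avoid-both P? Q? P-unique Q-unique = avoid Q? Q-unique (two-outside P? P-unique)

other : Fin 3 → Fin 3 → Fin 3
other i j = proj₁ (avoid-both (_≟ i) (_≟ j) (≡-unique i) (≡-unique j))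

other≢ : ∀ i j → other i j ≢ i × other i j ≢ j
other≢ i j = proj₂ (avoid-both (_≟ i) (_≟ j) (≡-unique i) (≡-unique j))

third-unique : ∀ (i j k l : Fin 3) → i ≢ j → k ≢ i → k ≢ j → l ≢ i → l ≢ j → k ≡ l
third-unique = from-yes (all? {n = 3} λ i → all? λ j → all? λ k → all? λ l →
  ¬? (i ≟ j) →-dec ¬? (k ≟ i) →-dec ¬? (k ≟ j) →-dec ¬? (l ≟ i) →-dec ¬? (l ≟ j) →-dec k ≟ l)

even : ℕ → Bool
even zero    = true
even (suc k) = not (even k)

even-+2 : ∀ k → even (k + 2) ≡ even k
even-+2 zero    = refl
even-+2 (suc k) = cong not (even-+2 k)

even-2* : ∀ k → even (2 * k) ≡ true
even-2* zero    = refl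
even-2* (suc k) = trans (cong even (*-suc 2 k)) (trans (not-involutive (even (2 * k))) (even-2* k))

module Cycle {n : ℕ} (1<n : 1 < n) where

  instance
    n-nonZero : NonZero n
    n-nonZero = >-nonZero (<-trans z<s 1<n)

  pred[n]<n : pred n < n
  pred[n]<n = subst (pred n <_) (suc-pred n) (n<1+n (pred n))

  origin : Fin n
  origin = fromℕ< (<-trans z<s 1<n)

  toℕ-origin : toℕ origin ≡ 0
  toℕ-origin = toℕ-fromℕ< _

  step-functional : ∀ {i j j'} → CycStep n i j → CycStep n i j' → j ≡ j'
  step-functional (inj₁ e)       (inj₁ e')       = toℕ-injective (trans (sym e) e')
  step-functional {j = j} (inj₁ e) (inj₂ (e' , _)) = contradiction (trans (sym e) e') (<⇒≢ (toℕ<n j))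
  step-functional {j' = j'} (inj₂ (e , _)) (inj₁ e') = contradiction (trans (sym e') e) (<⇒≢ (toℕ<n j'))
  step-functional (inj₂ (_ , z)) (inj₂ (_ , z')) = toℕ-injective (trans z (sym z'))

  step-injective : ∀ {i i' j} → CycStep n i j → CycStep n i' j → i ≡ i'
  step-injective (inj₁ e)       (inj₁ e')       = toℕ-injective (suc-injective (trans e (sym e')))
  step-injective (inj₁ e)       (inj₂ (_ , z))  = contradiction (trans e z) λ ()
  step-injective (inj₂ (_ , z)) (inj₁ e')       = contradiction (trans e' z) λ ()
  step-injective (inj₂ (e , _)) (inj₂ (e' , _)) = toℕ-injective (suc-injective (trans e (sym e')))

  successor : ∀ i → ∃ (CycStep n i)
  successor i with suc (toℕ i) <? n
  ... | yes i+1<n = fromℕ< i+1<n , inj₁ (sym (toℕ-fromℕ< i+1<n))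
  ... | no  i+1≮n = origin , inj₂ (≤-antisym (toℕ<n i) (≮⇒≥ i+1≮n) , toℕ-origin)

  predecessor : ∀ j → ∃ λ i → CycStep n i j
  predecessor j with toℕ j in eq
  ... | zero  = fromℕ< pred[n]<n , inj₂ (trans (cong suc (toℕ-fromℕ< pred[n]<n)) (suc-pred n) , refl)
  ... | suc k = fromℕ< k<n , inj₁ (cong suc (toℕ-fromℕ< k<n))
    where
    k<n : k < n
    k<n = <-trans (n<1+n k) (subst (_< n) eq (toℕ<n j))

  next prev : Fin n → Fin n
  next i = proj₁ (successor i)
  prev j = proj₁ (predecessor j)

  step-next : ∀ i → CycStep n i (next i)
  step-next i = proj₂ (successor i)

  step-prev : ∀ j → CycStep n (prev j) j
  step-prev j = proj₂ (predecessor j)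

  next-prev : ∀ j → next (prev j) ≡ j
  next-prev j = step-functional (step-next (prev j)) (step-prev j)

  prev-next : ∀ i → prev (next i) ≡ i
  prev-next i = step-injective (step-prev (next i)) (step-next i)

  adj⇒next : ∀ {a b} → CycAdj n a b → b ≡ next a ⊎ a ≡ next b
  adj⇒next (inj₁ st) = inj₁ (step-functional st (step-next _))
  adj⇒next (inj₂ st) = inj₂ (step-functional st (step-next _))

  next≢ : ∀ i → next i ≢ i
  next≢ i eq with subst (CycStep n i) eq (step-next i)
  ... | inj₁ e       = 1+n≢n e
  ... | inj₂ (e , z) = <⇒≢ 1<n (trans (cong suc (sym z)) e)

  prev≢ : ∀ i → prev i ≢ i
  prev≢ i eq = next≢ (prev i) (trans (next-prev i) (sym eq))

  rot unrot : ℕ → Fin n → Fin n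
  rot   zero    a = a
  rot   (suc k) a = next (rot k a)
  unrot zero    a = a
  unrot (suc k) a = unrot k (prev a)

  rot-next : ∀ k a → rot k (next a) ≡ next (rot k a)
  rot-next zero    a = refl
  rot-next (suc k) a = cong next (rot-next k a)

  rot-prev : ∀ k a → rot k (prev a) ≡ prev (rot k a)
  rot-prev k a = begin
    rot k (prev a)               ≡⟨ prev-next (rot k (prev a)) ⟨
    prev (next (rot k (prev a))) ≡⟨ cong prev (rot-next k (prev a)) ⟨
    prev (rot k (next (prev a))) ≡⟨ cong (prev ∘ rot k) (next-prev a) ⟩
    prev (rot k a)               ∎
    where open ≡-Reasoning

  rot-unrot : ∀ k a → rot k (unrot k a) ≡ a
  rot-unrot zero    a = refl
  rot-unrot (suc k) a = trans (cong next (rot-unrot k (prev a))) (next-prev a)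

  unrot-rot : ∀ k a → unrot k (rot k a) ≡ a
  unrot-rot zero    a = refl
  unrot-rot (suc k) a = trans (cong (unrot k) (prev-next (rot k a))) (unrot-rot k a)

  rot-injective : ∀ k {a b} → rot k a ≡ rot k b → a ≡ b
  rot-injective k {a} {b} eq = trans (sym (unrot-rot k a)) (trans (cong (unrot k) eq) (unrot-rot k b))

  unrot-injective : ∀ k {a b} → unrot k a ≡ unrot k b → a ≡ b
  unrot-injective k {a} {b} eq = trans (sym (rot-unrot k a)) (trans (cong (rot k) eq) (rot-unrot k b))

  rot-comm : ∀ j k a → rot j (rot k a) ≡ rot k (rot j a)
  rot-comm j zero    a = refl
  rot-comm j (suc k) a = trans (rot-next j (rot k a)) (cong next (rot-comm j k a))

  toℕ-rot-origin : ∀ {k} → k < n → toℕ (rot k origin) ≡ k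
  toℕ-rot-origin {zero}  _   = toℕ-origin
  toℕ-rot-origin {suc k} k<n with step-next (rot k origin) | toℕ-rot-origin (<-trans (n<1+n k) k<n)
  ... | inj₁ e       | ih = trans (sym e) (cong suc ih)
  ... | inj₂ (e , _) | ih = contradiction (trans (cong suc (sym ih)) e) (<⇒≢ k<n)

  rot-toℕ : ∀ c → rot (toℕ c) origin ≡ c
  rot-toℕ c = toℕ-injective (toℕ-rot-origin (toℕ<n c))

  reachable : ∀ a b → ∃[ k ] rot k a ≡ b
  reachable a b = toℕ c , (begin
    rot (toℕ c) a                      ≡⟨ cong (rot (toℕ c)) (rot-toℕ a) ⟨
    rot (toℕ c) (rot (toℕ a) origin)   ≡⟨ rot-comm (toℕ c) (toℕ a) origin ⟩
    rot (toℕ a) (rot (toℕ c) origin)   ≡⟨ cong (rot (toℕ a)) (rot-toℕ c) ⟩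
    rot (toℕ a) (unrot (toℕ a) b)      ≡⟨ rot-unrot (toℕ a) b ⟩
    b                                  ∎)
    where
    open ≡-Reasoning
    c : Fin n
    c = unrot (toℕ a) b

  boundary : {P : Fin n → Set} → Decidable P → ∀ {a b} → P a → ¬ P b → ∃[ c ] P c × ¬ P (next c)
  boundary {P} P? {a} {b} Pa ¬Pb with reachable a b
  ... | k , refl = along k ¬Pb
    where
    along : ∀ k → ¬ P (rot k a) → ∃[ c ] P c × ¬ P (next c)
    along zero    ¬Pa = contradiction Pa ¬Pa
    along (suc k) ¬P[k+1] with P? (rot k a)
    ... | yes P[k] = rot k a , P[k] , ¬P[k+1]
    ... | no ¬P[k] = along k ¬P[k]

  even-next : even n ≡ true → ∀ c → even (toℕ (next c)) ≡ not (even (toℕ c))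
  even-next n-even c with step-next c
  ... | inj₁ e       = cong even (sym e)
  ... | inj₂ (e , z) = trans (cong even z) (trans (sym n-even) (cong even (sym e)))

  neighbour-below : ∀ {k v c} → toℕ v ≡ suc k → toℕ c ≤ k → CycAdj n v c →
    c ≡ prev v ⊎ (c ≡ origin × v ≡ prev origin)
  neighbour-below _  _   (inj₂ st)             = inj₁ (step-injective st (step-prev _))
  neighbour-below {k} v=k+1 c≤k (inj₁ (inj₁ e)) =
    contradiction (≤-trans (n≤1+n (suc k)) (subst (_≤ k) (trans (sym e) (cong suc v=k+1)) c≤k)) 1+n≰n
  neighbour-below _  _   (inj₁ (inj₂ (e , z))) =
    inj₂ (toℕ-injective (trans z (sym toℕ-origin)) ,
          step-injective (inj₂ (e , toℕ-origin)) (step-prev origin))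

  step-unrot : ∀ k {a b} → CycStep n (rot k a) (rot k b) → CycStep n a b
  step-unrot k {a} {b} st = subst (CycStep n a) next-a≡b (step-next a)
    where
    next-a≡b : next a ≡ b
    next-a≡b = rot-injective k (trans (rot-next k a) (sym (step-functional st (step-next (rot k a)))))

  adj-unrot : ∀ k {a b} → CycAdj n (rot k a) (rot k b) → CycAdj n a b
  adj-unrot k (inj₁ st) = inj₁ (step-unrot k st)
  adj-unrot k (inj₂ st) = inj₂ (step-unrot k st)

record CycleCover (n : ℕ) (Col : Set) : Set₁ where
  field
    Edge          : Fin n → Col → Fin n → Col → Set
    edge?         : ∀ a i b j → Dec (Edge a i b j)
    edge-sym      : ∀ {a i b j} → Edge a i b j → Edge b j a i
    edge-cycle    : ∀ {a i b j} → a ≢ b → Edge a i b j → CycAdj n a b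
    edge-matching : ∀ {a i b j k} → a ≢ b → Edge a i b j → Edge a i b k → j ≡ k

  edge-unique : ∀ {a b u} → b ≢ a → AtMostOne (λ i → Edge a i b u)
  edge-unique b≢a e e' = edge-matching b≢a (edge-sym e) (edge-sym e')

  ProperOn : (Fin n → Set) → (Fin n → Col → Set) → (Fin n → Col) → Set
  ProperOn S L g = (∀ {c} → S c → L c (g c))
                 × (∀ {c c'} → S c → S c' → c ≢ c' → ¬ Edge c (g c) c' (g c'))

  Colouring : (Fin n → Col → Set) → Set
  Colouring L = Σ[ g ∈ (Fin n → Col) ] (∀ c → L c (g c))
                                     × (∀ {c c'} → c ≢ c' → ¬ Edge c (g c) c' (g c'))

  colouring-mono : ∀ {L L'} → (∀ {c i} → L c i → L' c i) → Colouring L → Colouring L'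
  colouring-mono L⊆L' (g , allowed , proper) = g , L⊆L' ∘ allowed , proper

  extend : ∀ {S S' L g v q} → ProperOn S L g → (∀ {c} → S' c → S c ⊎ c ≡ v) → (∀ {c} → S c → c ≢ v) →
    L v q → (∀ {c} → S c → ¬ Edge v q c (g c)) → ProperOn S' L (updateAt g v (const q))
  extend {S} {S'} {L} {g} {v} {q} (allowed , proper) split S≢v Lq fresh =
    (λ S'c → allowed' (classify S'c)) , λ S'c S'c' → proper' (classify S'c) (classify S'c')
    where
    g' : Fin n → Col
    g' = updateAt g v (const q)
    OldOrNew : Fin n → Set
    OldOrNew c = (S c × g' c ≡ g c) ⊎ (c ≡ v × g' c ≡ q)
    classify : ∀ {c} → S' c → OldOrNew c
    classify S'c with split S'c
    ... | inj₁ Sc   = inj₁ (Sc , updateAt-minimal _ v g (S≢v Sc))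
    ... | inj₂ refl = inj₂ (refl , updateAt-updates v g)
    allowed' : ∀ {c} → OldOrNew c → L c (g' c)
    allowed' (inj₁ (Sc , eq))   = subst (L _) (sym eq) (allowed Sc)
    allowed' (inj₂ (refl , eq)) = subst (L v) (sym eq) Lq
    proper' : ∀ {c c'} → OldOrNew c → OldOrNew c' → c ≢ c' → ¬ Edge c (g' c) c' (g' c')
    proper' (inj₁ (Sc , eq))   (inj₁ (Sc' , eq'))  c≢c' rewrite eq | eq' = proper Sc Sc' c≢c'
    proper' (inj₁ (Sc , eq))   (inj₂ (refl , eq')) _    rewrite eq | eq' = fresh Sc ∘ edge-sym
    proper' (inj₂ (refl , eq)) (inj₁ (Sc' , eq'))  _    rewrite eq | eq' = fresh Sc'
    proper' (inj₂ (refl , _))  (inj₂ (refl , _))   c≢c' = contradiction refl c≢c'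

module CycleColouring {n : ℕ} (1<n : 1 < n) where
  open Cycle 1<n
  open CycleCover using (Colouring)

  rotate : ∀ {Col} → CycleCover n Col → ℕ → CycleCover n Col
  rotate E k = record
    { Edge          = λ a i b j → Edge (rot k a) i (rot k b) j
    ; edge?         = λ a i b j → edge? (rot k a) i (rot k b) j
    ; edge-sym      = edge-sym
    ; edge-cycle    = λ a≢b → adj-unrot k ∘ edge-cycle (a≢b ∘ rot-injective k)
    ; edge-matching = λ a≢b → edge-matching (a≢b ∘ rot-injective k)
    }
    where open CycleCover E

  unrotate : ∀ {Col} (E : CycleCover n Col) k {L} → Colouring (rotate E k) (L ∘ rot k) → Colouring E L
  unrotate E k {L} (g , allowed , proper) = g ∘ unrot k , allowed' , proper'
    where
    open CycleCover E using (Edge)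
    allowed' : ∀ c → L c (g (unrot k c))
    allowed' c = subst (λ a → L a (g (unrot k c))) (rot-unrot k c) (allowed (unrot k c))
    proper' : ∀ {c c'} → c ≢ c' → ¬ Edge c (g (unrot k c)) c' (g (unrot k c'))
    proper' {c} {c'} c≢c' = proper (c≢c' ∘ unrot-injective k) ∘
      subst₂ (λ a a' → Edge a (g (unrot k c)) a' (g (unrot k c'))) (sym (rot-unrot k c)) (sym (rot-unrot k c'))

  module _ {Col} (E : CycleCover n Col) where
    open CycleCover E hiding (Colouring)

    proper-from-steps : (g : Fin n → Col) → (∀ c → ¬ Edge c (g c) (next c) (g (next c))) →
      ∀ {c c'} → c ≢ c' → ¬ Edge c (g c) c' (g c')
    proper-from-steps g ok {c} {c'} c≢c' e with adj⇒next (edge-cycle c≢c' e)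
    ... | inj₁ refl = ok c e
    ... | inj₂ refl = ok c' (edge-sym e)

  module _ {Col} (E : CycleCover n Col) {L : Fin n → Col → Set} (two : ∀ c → HasTwo (L c)) where
    open CycleCover E hiding (Colouring)

    -- Colour the vertices in the order of their indices; only the last one, prev origin, has two
    -- coloured neighbours.
    greedy : ∀ {p} → L origin p →
      (∀ u → ∃[ q ] L (prev origin) q × ¬ Edge (prev origin) q (prev (prev origin)) u
                                      × ¬ Edge (prev origin) q origin p) →
      Colouring E L
    greedy {p} Lp last-ok with build (pred n) pred[n]<n
      where
      Partial : ℕ → Set
      Partial k = Σ[ g ∈ (Fin n → Col) ] g origin ≡ p × ProperOn (λ c → toℕ c ≤ k) L g

      below≢ : ∀ {k c v} → toℕ c ≤ k → toℕ v ≡ suc k → c ≢ v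
      below≢ c≤k v=k+1 refl = 1+n≰n (subst (_≤ _) v=k+1 c≤k)

      upto-zero : ∀ {c} → toℕ c ≤ 0 → c ≡ origin
      upto-zero c≤0 = toℕ-injective (trans (n≤0⇒n≡0 c≤0) (sym toℕ-origin))

      choose : ∀ (g : Fin n → Col) v →
        ∃[ q ] L v q × ¬ Edge v q (prev v) (g (prev v)) × (v ≡ prev origin → ¬ Edge v q origin p)
      choose g v with v ≟ prev origin
      ... | yes refl =
        let (q , Lq , ¬prev , ¬first) = last-ok (g (prev v)) in q , Lq , ¬prev , const ¬first
      ... | no v≢last =
        let (q , Lq , ¬prev) = avoid (λ i → edge? v i (prev v) (g (prev v))) (edge-unique (prev≢ v)) (two v)
        in q , Lq , ¬prev , λ v≡last → contradiction v≡last v≢last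

      step : ∀ {k} v → toℕ v ≡ suc k → Partial k → Partial (suc k)
      step {k} v v=k+1 (g , g₀ , proper) with choose g v
      ... | q , Lq , ¬prev , ¬first =
        updateAt g v (const q) , trans (updateAt-minimal origin v g origin≢v) g₀ ,
        extend proper split (λ c≤k → below≢ c≤k v=k+1) Lq fresh
        where
        origin≢v : origin ≢ v
        origin≢v = below≢ (subst (_≤ k) (sym toℕ-origin) z≤n) v=k+1
        split : ∀ {c} → toℕ c ≤ suc k → toℕ c ≤ k ⊎ c ≡ v
        split c≤k+1 with m≤n⇒m<n∨m≡n c≤k+1
        ... | inj₁ c<k+1 = inj₁ (≤-pred c<k+1)
        ... | inj₂ c=k+1 = inj₂ (toℕ-injective (trans c=k+1 (sym v=k+1)))
        fresh : ∀ {c} → toℕ c ≤ k → ¬ Edge v q c (g c)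
        fresh c≤k e with neighbour-below v=k+1 c≤k (edge-cycle (below≢ c≤k v=k+1 ∘ sym) e)
        ... | inj₁ refl            = ¬prev e
        ... | inj₂ (refl , v≡last) = ¬first v≡last (subst (Edge v q origin) g₀ e)

      build : ∀ k → k < n → Partial k
      build zero    _     = const p , refl , (λ c≤0 → subst (λ c → L c p) (sym (upto-zero c≤0)) Lp) ,
        λ c≤0 c'≤0 c≢c' → contradiction (trans (upto-zero c≤0) (sym (upto-zero c'≤0))) c≢c'
      build (suc k) k+1<n = step (fromℕ< k+1<n) (toℕ-fromℕ< k+1<n) (build k (<-trans (n<1+n k) k+1<n))
    ... | g , _ , allowed , proper =
      g , (λ c → allowed (below c)) , λ c≢c' → proper (below _) (below _) c≢c'
      where
      below : ∀ c → toℕ c ≤ pred n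
      below c = <⇒≤pred (toℕ<n c)

  module _ {Col} (E : CycleCover n Col) {L : Fin n → Col → Set} (two : ∀ c → HasTwo (L c)) where
    open CycleCover E hiding (Colouring)

    colouring-from : ∀ ℓ {p} → L (next ℓ) p →
      (∀ u → ∃[ q ] L ℓ q × ¬ Edge ℓ q (prev ℓ) u × ¬ Edge ℓ q (next ℓ) p) → Colouring E L
    colouring-from ℓ {p} Lp last-ok = unrotate E k {L} (greedy (rotate E k) (two ∘ rot k) Lp' last-ok')
      where
      k : ℕ
      k = toℕ (next ℓ)
      Lp' : L (rot k origin) p
      Lp' = subst (λ c → L c p) (sym (rot-toℕ (next ℓ))) Lp
      last-ok' : ∀ u → ∃[ q ] L (rot k (prev origin)) q
                            × ¬ Edge (rot k (prev origin)) q (rot k (prev (prev origin))) u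
                            × ¬ Edge (rot k (prev origin)) q (rot k origin) p
      last-ok' rewrite rot-prev k (prev origin) | rot-prev k origin | rot-toℕ (next ℓ) | prev-next ℓ = last-ok

    colouring-if-isolated : ∀ ℓ {p} → L (next ℓ) p → (∀ {q} → L ℓ q → ¬ Edge ℓ q (next ℓ) p) → Colouring E L
    colouring-if-isolated ℓ Lp isolated = colouring-from ℓ Lp λ u →
      let (q , Lq , ¬prev) = avoid (λ i → edge? ℓ i (prev ℓ) u) (edge-unique (prev≢ ℓ)) (two ℓ)
      in q , Lq , ¬prev , isolated Lq

module ThreeColours {n : ℕ} (1<n : 1 < n) (E : CycleCover n (Fin 3)) where
  open Cycle 1<n
  open CycleColouring 1<n
  open CycleCover E

  Without : (Fin n → Fin 3) → Fin n → Fin 3 → Set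
  Without r c i = i ≢ r c

  two-without : ∀ r c → HasTwo (Without r c)
  two-without r c = two-outside (_≟ r c) (≡-unique (r c))

  colouring-if-full : ∀ {L} → (∀ c → HasTwo (L c)) → ∀ ℓ → (∀ i → L ℓ i) → Colouring L
  colouring-if-full two ℓ full with two (next ℓ)
  ... | p , _ , _ , Lp , _ = colouring-from E two ℓ Lp λ u →
    let (q , ¬prev , ¬first) = avoid-both (λ i → edge? ℓ i (prev ℓ) u) (λ i → edge? ℓ i (next ℓ) p)
                                          (edge-unique (prev≢ ℓ)) (edge-unique (next≢ ℓ))
    in q , full q , ¬prev , ¬first

  module Uncolourable {r : Fin n → Fin 3} (stuck : ¬ Colouring (Without r)) where

    removed-forward : ∀ c {e} → e ≢ r (next c) → ¬ Edge c (r c) (next c) e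
    removed-forward c e≢r edge = stuck (colouring-if-isolated E (two-without r) c e≢r
      λ q≢r edge' → q≢r (edge-unique (next≢ c) edge' edge))

    allowed-neighbour : ∀ c {d} → d ≢ r (next c) → ∃[ e ] e ≢ r c × Edge c e (next c) d
    allowed-neighbour c {d} d≢r with any? (λ e → ¬? (e ≟ r c) ×-dec edge? c e (next c) d)
    ... | yes found = found
    ... | no none   = contradiction (colouring-if-isolated E (two-without r) c d≢r
                                       λ e≢r edge → none (_ , e≢r , edge)) stuck

    removed-backward : ∀ c {e} → e ≢ r c → ¬ Edge (next c) (r (next c)) c e
    removed-backward c {e} e≢r edge with two-without r (next c)
    ... | d₁ , d₂ , d₁≢d₂ , d₁≢r , d₂≢r with allowed-neighbour c d₁≢r | allowed-neighbour c d₂≢r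
    ... | e₁ , e₁≢r , edge₁ | e₂ , e₂≢r , edge₂ =
      e≢r (third-unique e₁ e₂ e (r c) e₁≢e₂ (e≢neighbour d₁≢r edge₁) (e≢neighbour d₂≢r edge₂)
                                            (e₁≢r ∘ sym) (e₂≢r ∘ sym))
      where
      e₁≢e₂ : e₁ ≢ e₂
      e₁≢e₂ refl = d₁≢d₂ (edge-matching (next≢ c ∘ sym) edge₁ edge₂)
      e≢neighbour : ∀ {d e'} → d ≢ r (next c) → Edge c e' (next c) d → e ≢ e'
      e≢neighbour d≢r edge' refl = d≢r (edge-matching (next≢ c ∘ sym) edge' (edge-sym edge))

  module _ {r r' : Fin n → Fin 3} (stuck : ¬ Colouring (Without r)) (stuck' : ¬ Colouring (Without r')) where
    open Uncolourable stuck

    agreement-propagates : ∀ c → r c ≡ r' c → ¬ r (next c) ≢ r' (next c)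
    agreement-propagates c eq neq = stuck' (colouring-if-isolated E (two-without r') c neq
      λ q≢r' edge → removed-backward c (subst (_ ≢_) (sym eq) q≢r') (edge-sym edge))

    disagreement-somewhere : even n ≡ true → ¬ (∀ c → r c ≢ r' c)
    disagreement-somewhere n-even r≢r' = stuck' (g , (λ c → allowed (even (toℕ c)) c) , proper-from-steps E g
      λ c → subst (λ b → ¬ Edge c (g c) (next c) (pick b (next c))) (sym (even-next n-even c))
                  (step-ok (even (toℕ c)) c))
      where
      pick : Bool → Fin n → Fin 3
      pick true  c = r c
      pick false c = other (r c) (r' c)
      g : Fin n → Fin 3
      g c = pick (even (toℕ c)) c
      allowed : ∀ b c → pick b c ≢ r' c
      allowed true  c = r≢r' c
      allowed false c = proj₂ (other≢ (r c) (r' c))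
      step-ok : ∀ b c → ¬ Edge c (pick b c) (next c) (pick (not b) (next c))
      step-ok true  c = removed-forward c (proj₁ (other≢ _ _))
      step-ok false c = removed-backward c (proj₁ (other≢ _ _)) ∘ edge-sym

    uncolourable-unique : even n ≡ true → ∀ c → r c ≡ r' c
    uncolourable-unique n-even c₀ with r c₀ ≟ r' c₀ | any? (λ c → r c ≟ r' c)
    ... | yes eq  | _            = eq
    ... | no r≢r' | yes (_ , eq) =
      let (c , agree , disagree) = boundary (λ c → r c ≟ r' c) eq r≢r'
      in ⊥-elim (agreement-propagates c agree disagree)
    ... | no _    | no none      = ⊥-elim (disagreement-somewhere n-even λ c eq → none (c , eq))

even-cyc : ∀ m → even (cyc m) ≡ true
even-cyc m = trans (even-+2 (2 * m)) (even-2* m)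

1<cyc : ∀ m → 1 < cyc m
1<cyc m = m≤n+m 2 (2 * m)

module _ (m t : ℕ) (H : Cover3 (MAdj m t)) (q : Fin t) where
  open Cover3 H renaming (sym to Adj-sym)
  open CycleCover using (Colouring; colouring-mono)

  -- ((c , y q) , i) ∉ D_q: its only possible neighbour in the colouring f of M_X is ((c , x) , f c).
  Removed : (Fin (cyc m) → Fin 3) → Fin (cyc m) → Fin 3 → Set
  Removed f c i = Adj ((c , y q) , i) ((c , x) , f c)

  removed-unique : ∀ f c → AtMostOne (Removed f c)
  removed-unique f c e e' = matching (c , x) (c , y q) (f c) _ _ (λ ()) (Adj-sym _ _ e) (Adj-sym _ _ e')

  layer : (∀ a i b j → Dec (Adj ((a , y q) , i) ((b , y q) , j))) → CycleCover (cyc m) (Fin 3)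
  layer adj? = record
    { Edge          = λ a i b j → Adj ((a , y q) , i) ((b , y q) , j)
    ; edge?         = adj?
    ; edge-sym      = Adj-sym _ _
    ; edge-cycle    = λ a≢b e → cycle-part (edge _ _ _ _ (a≢b ∘ cong proj₁) e)
    ; edge-matching = λ a≢b → matching _ _ _ _ _ (a≢b ∘ cong proj₁)
    }
    where
    cycle-part : ∀ {a b} → MAdj m t (a , y q) (b , y q) → CycAdj (cyc m) a b
    cycle-part (inj₁ (_ , ()))
    cycle-part (inj₂ (_ , a~b)) = a~b

  module _ (adj? : ∀ a i b j → Dec (Adj ((a , y q) , i) ((b , y q) , j)))
           (removed? : ∀ c i j → Dec (Adj ((c , y q) , i) ((c , x) , j))) where
    open ThreeColours (1<cyc m) (layer adj?)

    reduced-colouring : ∀ {f} → Colouring (layer adj?) (λ c i → ¬ Removed f c i) →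
      Σ (Fin (cyc m) → Fin 3) (IsReducedYColoring m t H q f)
    reduced-colouring {f} (g , allowed , proper) = g , (λ c c' → fresh (c ≟ c')) , λ c c' → proper' (c ≟ c')
      where
      fresh : ∀ {c c'} → Dec (c ≡ c') → ¬ Adj ((c , y q) , g c) ((c' , x) , f c')
      fresh (yes refl) = allowed _
      fresh (no c≢c') e with edge _ _ _ _ (λ ()) e
      ... | inj₁ (c≡c' , _) = c≢c' c≡c'
      ... | inj₂ (() , _)
      proper' : ∀ {c c'} → Dec (c ≡ c') → ¬ Adj ((c , y q) , g c) ((c' , y q) , g c')
      proper' (yes refl) = irrefl _
      proper' (no c≢c')  = proper c≢c'

    volatile-removal : ∀ {f} → Volatile m t H q f →
      Σ[ r ∈ (Fin (cyc m) → Fin 3) ] (∀ c → Removed f c (r c)) × ¬ Colouring (layer adj?) (Without r)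
    volatile-removal {f} volatile =
      r , removed , volatile ∘ reduced-colouring ∘ colouring-mono (layer adj?) {Without r} kept
      where
      two-kept : ∀ c → HasTwo (λ i → ¬ Removed f c i)
      two-kept c = two-outside (λ i → removed? c i (f c)) (removed-unique f c)
      some-removed : ∀ c → ∃ (Removed f c)
      some-removed c with any? (λ i → removed? c i (f c))
      ... | yes found = found
      ... | no none   = ⊥-elim (volatile (reduced-colouring (colouring-if-full two-kept c λ i e → none (i , e))))
      r : Fin (cyc m) → Fin 3
      r c = proj₁ (some-removed c)
      removed : ∀ c → Removed f c (r c)
      removed c = proj₂ (some-removed c)
      kept : ∀ {c i} → Without r c i → ¬ Removed f c i
      kept i≢r e = i≢r (removed-unique f _ e (removed _))

    volatile-unique : ∀ {I J} → Volatile m t H q I → Volatile m t H q J → ∀ c → I c ≡ J c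
    volatile-unique vI vJ c with volatile-removal vI | volatile-removal vJ
    ... | rI , removedI , stuckI | rJ , removedJ , stuckJ =
      matching (c , y q) (c , x) (rI c) _ _ (λ ()) (removedI c)
        (subst (λ i → Adj ((c , y q) , i) _) (sym rI≡rJ) (removedJ c))
      where
      rI≡rJ : rI c ≡ rJ c
      rI≡rJ = uncolourable-unique stuckI stuckJ (even-cyc m) c

¬¬-∀ : ∀ {k} {P : Fin k → Set} → (∀ i → DoubleNegation (P i)) → DoubleNegation (∀ i → P i)
¬¬-∀ = sequence (RawMonad.rawApplicative ¬¬-Monad)

-- Adj need not be decidable, but the goal is a decidable equation in Fin 3, so decidability of the
-- finitely many adjacencies in play may be assumed.
lemma16 : (m t : ℕ) (H : Cover3 (MAdj m t)) (q : Fin t)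
    (I J : Fin (cyc m) → Fin 3) →
    IsXColoring m t H I → IsXColoring m t H J →
    Volatile m t H q I → Volatile m t H q J →
    ∀ c → I c ≡ J c
lemma16 m t H q I J _ _ vI vJ c = decidable-stable (I c ≟ J c) do
  adj?     ← ¬¬-∀ λ a → ¬¬-∀ λ i → ¬¬-∀ λ b → ¬¬-∀ λ j → ¬¬-excluded-middle
  removed? ← ¬¬-∀ λ c → ¬¬-∀ λ i → ¬¬-∀ λ j → ¬¬-excluded-middle
  pure (volatile-unique m t H q adj? removed? vI vJ c)
  where open RawMonad ¬¬-Monad
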